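{- For every positive integer $k$ and every $\varepsilon>0$, the matrix $Q_k$ is $(\varepsilon,\frac{\varepsilon}{2k})$-good.
   Context: $Q_k$ denotes the $2\times (k+1)$ zero-one matrix with $Q_k(1,i)=1$ for $i=1,\dots,k$ and all other entries 0 (e.g. $Q_1=\begin{pmatrix}1&0\\0&0\end{pmatrix}$). A zero-one matrix $P$ is $(\varepsilon,\delta)$-good if for all $n$, every $n\times n$ $P$-free zero-one matrix with at least $\varepsilon n^2$ 0-entries contains a $\delta n\times\delta n$ all-0 submatrix. A $k\times \ell$ matrix $P$ is contained in $A$ if there are rows $i_1<\dots<i_k$ and columns $j_1<\dots<j_\ell$ of $A$ with $A(i_a,j_b)=P(a,b)$ for all $a,b$; $A$ is $P$-free if it does not contain $P$. Floors and ceilings are omitted.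
   Formalization: The parameter ε ranges over the positive rationals. -}

module Defs where

open import Data.Bool using (Bool; true; false; if_then_else_)
open import Data.Nat as ℕ using (ℕ; zero; suc; _<ᵇ_; NonZero)
open import Data.Fin as Fin using (Fin; toℕ)
open import Data.Integer as ℤ using (ℤ; +_)
open import Data.Rational as ℚ using (ℚ; floor)
open import Data.Product using (Σ; ∃; _×_)

-- zero-one matrices with m rows and n columns (true = 1, false = 0)
Matrix : ℕ → ℕ → Set
Matrix m n = Fin m → Fin n → Bool

Increasing : ∀ {a b} → (Fin a → Fin b) → Set
Increasing f = ∀ i j → i Fin.< j → f i Fin.< f j

Contains : ∀ {m n k l} → Matrix m n → Matrix k l → Set
Contains {m} {n} {k} {l} A P =
  Σ (Fin k → Fin m) λ r → Σ (Fin l → Fin n) λ c →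
    Increasing r × Increasing c × (∀ a b → A (r a) (c b) ≡B P a b)
  where
    open import Relation.Binary.PropositionalEquality renaming (_≡_ to _≡B_)

Free : ∀ {m n k l} → Matrix m n → Matrix k l → Set
Free A P = Contains A P → ⊥
  where open import Data.Empty using (⊥)

-- Q_k : 2 × (k+1), Q_k(1,i) = 1 for i = 1..k, all other entries 0
Q : (k : ℕ) → Matrix 2 (suc k)
Q k Fin.zero j = toℕ j <ᵇ k
Q k (Fin.suc _) j = false

sumFin : (n : ℕ) → (Fin n → ℕ) → ℕ
sumFin zero f = 0
sumFin (suc n) f = f Fin.zero ℕ.+ sumFin n (λ i → f (Fin.suc i))

zeros : ∀ {m n} → Matrix m n → ℕ
zeros {m} {n} A = sumFin m λ i → sumFin n λ j → if A i j then 0 else 1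

HasZeroSubmatrix : ∀ {n} → Matrix n n → ℕ → Set
HasZeroSubmatrix {n} A t =
  Σ (Fin t → Fin n) λ r → Σ (Fin t → Fin n) λ c →
    Increasing r × Increasing c × (∀ a b → A (r a) (c b) ≡B false)
  where
    open import Relation.Binary.PropositionalEquality renaming (_≡_ to _≡B_)

ℕ→ℚ : ℕ → ℚ
ℕ→ℚ n = + n ℚ./ 1

-- P is (ε, δ)-good: for all n, every n × n P-free matrix with at least ε n² 0-entries
-- contains a ⌊δ n⌋ × ⌊δ n⌋ all-0 submatrix (read: a t × t one with t ≥ ⌊δ n⌋)
Good : ∀ {k l} → ℚ → ℚ → Matrix k l → Set
Good {k} {l} ε δ P =
  (n : ℕ) (A : Matrix n n) → Free A P →
  (ε ℚ.* ℕ→ℚ (n ℕ.* n)) ℚ.≤ ℕ→ℚ (zeros A) →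
  ∃ λ t → (floor (δ ℚ.* ℕ→ℚ n) ℤ.≤ + t) × HasZeroSubmatrix A t

εOver2k : ℚ → (k : ℕ) → .{{NonZero k}} → ℚ
εOver2k ε (suc m) = ε ℚ.* (+ 1 ℚ./ (2 ℕ.* suc m))

-- Let t = ⌊εn/2k⌋ ≥ 1 and m = kt. Discard the first m zeros of every row. At least
-- εn² ≥ 2ktn zeros were present, so more than n(t − 1) survive and some column c
-- holds t surviving zeros, in rows r₁ < ⋯ < r_t. Row r_t has m zeros left of c, in
-- columns S. A row r_a above r_t with k ones in S would, together with row r_t and
-- column c, form a copy of Q_k; so every r_a has fewer than k ones in S. These are at
-- most (k − 1)t ones among kt columns, so t columns of S vanish on all the rows r_a.

module Submission where

open import Defs
open import Data.Nat using (ℕ; NonZero)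
open import Data.Rational using (ℚ; 0ℚ; _<_)

open import Data.Bool using (Bool; true; false; not; if_then_else_)
open import Data.Bool.Properties using (T-≡; not-injective)
open import Data.Empty using (⊥-elim)
open import Data.Fin as F using (Fin; toℕ; fromℕ; inject₁)
open import Data.Fin.Properties
  using (¬∀⟶∃¬; toℕ<n; toℕ≤pred[n]; toℕ-fromℕ; toℕ-inject₁)
open import Data.Fin.Relation.Unary.Top using (view; ‵fromℕ; ‵inject₁)
open import Data.Nat as N
  using (zero; suc; pred; _+_; _*_; _≤_; z≤n; s≤s; s≤s⁻¹; _<ᵇ_; _≡ᵇ_)
open import Data.Nat.Properties
open import Data.Nat.Coprimality using (Coprime)
open import Data.Nat.Tactic.RingSolver using (solve-∀)
open import Algebra.Properties.CommutativeMonoid.Sum +-0-commutativeMonoid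
  using (sum; sum-syntax; sum-cong-≗; sum-replicate-zero; ∑-comm; ∑-distrib-+)
open import Data.Integer as ℤ using (-[1+_])
import Data.Integer.Properties as ℤ
open import Data.Integer.DivMod using ([n/d]*d≤n)
import Data.Rational as ℚ
import Data.Rational.Properties as ℚ
open import Data.Rational.Unnormalised as ℚᵘ using (mkℚᵘ)
import Data.Rational.Unnormalised.Properties as ℚᵘ
open import Data.Product using (∃; _×_; _,_; proj₁; proj₂; map₁; map₂)
open import Data.Vec.Functional using (_∷_; [])
open import Function using (_∘_; Equivalence)
open import Relation.Nullary using (yes; no)
open import Relation.Binary.PropositionalEquality

indicator : Bool → ℕ
indicator b = if b then 1 else 0

count : ∀ {n} → (Fin n → Bool) → ℕ
count {n} p = ∑[ i < n ] indicator (p i)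

sumFin≡sum : ∀ n (f : Fin n → ℕ) → sumFin n f ≡ sum f
sumFin≡sum zero    f = refl
sumFin≡sum (suc n) f = cong (f F.zero +_) (sumFin≡sum n (f ∘ F.suc))

zeros≡sum-count : ∀ {m n} (A : Matrix m n) → zeros A ≡ ∑[ i < m ] count (not ∘ A i)
zeros≡sum-count {m} {n} A = begin
  zeros A                                             ≡⟨ sumFin≡sum m _ ⟩
  ∑[ i < m ] sumFin n (λ j → if A i j then 0 else 1)
    ≡⟨ sum-cong-≗ (λ i → sumFin≡sum n (λ j → if A i j then 0 else 1)) ⟩
  ∑[ i < m ] ∑[ j < n ] (if A i j then 0 else 1)
    ≡⟨ sum-cong-≗ (λ i → sum-cong-≗ (λ j → if-not (A i j))) ⟩
  ∑[ i < m ] count (not ∘ A i)                        ∎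
  where
  open ≡-Reasoning
  if-not : ∀ b → (if b then 0 else 1) ≡ indicator (not b)
  if-not true  = refl
  if-not false = refl

sum-const : ∀ n c → ∑[ _ < n ] c ≡ n * c
sum-const zero    c = refl
sum-const (suc n) c = cong (c +_) (sum-const n c)

sum-mono-≤ : ∀ {n} {f g : Fin n → ℕ} → (∀ i → f i ≤ g i) → sum f ≤ sum g
sum-mono-≤ {zero}  f≤g = z≤n
sum-mono-≤ {suc n} f≤g = +-mono-≤ (f≤g F.zero) (sum-mono-≤ (f≤g ∘ F.suc))

sum-pigeonhole : ∀ {n} u (g : Fin n → ℕ) → n * u N.< sum g → ∃ λ c → u N.< g c
sum-pigeonhole {n} u g n*u<∑g with ¬∀⟶∃¬ n (λ c → g c ≤ u) (λ c → g c ≤? u) all≤u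
  where
  all≤u : (∀ c → g c ≤ u) → _
  all≤u g≤u = <⇒≱ n*u<∑g (≤-trans (sum-mono-≤ g≤u) (≤-reflexive (sum-const n u)))
... | c , g≰u = c , ≰⇒> g≰u

≤-countZeros+sum : ∀ {n} (g : Fin n → ℕ) → n ≤ count (λ i → g i ≡ᵇ 0) + sum g
≤-countZeros+sum {n} g = begin
  n                                          ≡⟨ sym (trans (sum-const n 1) (*-identityʳ n)) ⟩
  ∑[ _ < n ] 1                               ≤⟨ sum-mono-≤ (λ i → one≤ (g i)) ⟩
  ∑[ i < n ] (indicator (g i ≡ᵇ 0) + g i)    ≡⟨ ∑-distrib-+ _ g ⟩
  count (λ i → g i ≡ᵇ 0) + sum g             ∎
  where
  open ≤-Reasoning
  one≤ : ∀ x → 1 ≤ indicator (x ≡ᵇ 0) + x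
  one≤ zero    = s≤s z≤n
  one≤ (suc x) = s≤s z≤n

count-false : ∀ {n} (p : Fin n → Bool) → (∀ i → p i ≡ false) → count p ≡ 0
count-false {n} p p≡false = trans (sum-cong-≗ (cong indicator ∘ p≡false)) (sum-replicate-zero n)

count≡ᵇ0⇒false : ∀ {n} (p : Fin n → Bool) → (count p ≡ᵇ 0) ≡ true → ∀ i → p i ≡ false
count≡ᵇ0⇒false {suc n} p h i with p F.zero in p₀
count≡ᵇ0⇒false p h F.zero    | false = p₀
count≡ᵇ0⇒false p h (F.suc i) | false = count≡ᵇ0⇒false (p ∘ F.suc) h i

record Picks {n} (t : ℕ) (P : Fin n → Set) : Set where
  field
    index      : Fin t → Fin n
    increasing : Increasing index
    satisfies  : ∀ a → P (index a)
open Picks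

picks-zero : ∀ {n} {P : Fin n → Set} → Picks 0 P
picks-zero = record { index = λ () ; increasing = λ () ; satisfies = λ () }

picks-map : ∀ {n t} {P R : Fin n → Set} → (∀ {i} → P i → R i) → Picks t P → Picks t R
picks-map f S = record { index = index S ; increasing = increasing S ; satisfies = f ∘ satisfies S }

picks-shift : ∀ {n t} {P : Fin (suc n) → Set} → Picks t (P ∘ F.suc) → Picks t P
picks-shift S = record
  { index = F.suc ∘ index S
  ; increasing = λ a b a<b → s≤s (increasing S a b a<b)
  ; satisfies = satisfies S
  }

picks-cons : ∀ {n t} {P : Fin (suc n) → Set} → P F.zero → Picks t (P ∘ F.suc) → Picks (suc t) P
picks-cons {P = P} P₀ S =
  record { index = index′ ; increasing = increasing′ ; satisfies = satisfies′ }
  where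
  index′ : Fin (suc _) → Fin (suc _)
  index′ F.zero    = F.zero
  index′ (F.suc a) = F.suc (index S a)
  increasing′ : Increasing index′
  increasing′ F.zero    (F.suc b) _         = s≤s z≤n
  increasing′ (F.suc a) (F.suc b) (s≤s a<b) = s≤s (increasing S a b a<b)
  satisfies′ : ∀ a → P (index′ a)
  satisfies′ F.zero    = P₀
  satisfies′ (F.suc a) = satisfies S a

count⇒picks : ∀ {n t} (p : Fin n → Bool) → t ≤ count p → Picks t (λ i → p i ≡ true)
count⇒picks {t = zero} p _ = picks-zero
count⇒picks {suc n} {suc t} p t<count with p F.zero in p₀
... | true  = picks-cons p₀ (count⇒picks (p ∘ F.suc) (s≤s⁻¹ t<count))
... | false = picks-shift (count⇒picks (p ∘ F.suc) t<count)

dropTrues : ∀ {n} → ℕ → (Fin n → Bool) → Fin n → Bool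
dropTrues zero    p = p
dropTrues (suc m) p F.zero    = false
dropTrues (suc m) p (F.suc j) = dropTrues (if p F.zero then m else suc m) (p ∘ F.suc) j

count≤+count-dropTrues : ∀ {n} m (p : Fin n → Bool) → count p ≤ m + count (dropTrues m p)
count≤+count-dropTrues zero    p = ≤-refl
count≤+count-dropTrues {zero}  (suc m) p = z≤n
count≤+count-dropTrues {suc n} (suc m) p with p F.zero
... | true  = s≤s (count≤+count-dropTrues m (p ∘ F.suc))
... | false = count≤+count-dropTrues (suc m) (p ∘ F.suc)

dropTrues⇒true : ∀ {n} m (p : Fin n → Bool) j → dropTrues m p j ≡ true → p j ≡ true
dropTrues⇒true zero    p j         h = h
dropTrues⇒true (suc m) p (F.suc j) h = dropTrues⇒true (if p F.zero then m else suc m) (p ∘ F.suc) j h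

dropTrues⇒preceded : ∀ {n} m (p : Fin n → Bool) j → dropTrues m p j ≡ true →
  Picks m (λ i → p i ≡ true × i F.< j)
dropTrues⇒preceded zero    p j         h = picks-zero
dropTrues⇒preceded (suc m) p (F.suc j) h with p F.zero in p₀
... | true  =
  picks-cons (p₀ , s≤s z≤n) (picks-map (map₂ s≤s) (dropTrues⇒preceded m (p ∘ F.suc) j h))
... | false = picks-shift (picks-map (map₂ s≤s) (dropTrues⇒preceded (suc m) (p ∘ F.suc) j h))

snoc : ∀ {k} {X : Set} → (Fin k → X) → X → Fin (suc k) → X
snoc {zero}  f x _         = x
snoc {suc k} f x F.zero    = f F.zero
snoc {suc k} f x (F.suc j) = snoc (f ∘ F.suc) x j

snoc-inject₁ : ∀ {k} {X : Set} (f : Fin k → X) x b → snoc f x (inject₁ b) ≡ f b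
snoc-inject₁ {suc k} f x F.zero    = refl
snoc-inject₁ {suc k} f x (F.suc b) = snoc-inject₁ (f ∘ F.suc) x b

snoc-fromℕ : ∀ {k} {X : Set} (f : Fin k → X) x → snoc f x (fromℕ k) ≡ x
snoc-fromℕ {zero}  f x = refl
snoc-fromℕ {suc k} f x = snoc-fromℕ (f ∘ F.suc) x

snoc-increasing : ∀ {k n} (f : Fin k → Fin n) x → Increasing f → (∀ b → f b F.< x) →
  Increasing (snoc f x)
snoc-increasing {k} f x f↑ f<x i j i<j with view i | view j
... | ‵inject₁ a | ‵inject₁ b
  rewrite snoc-inject₁ f x a | snoc-inject₁ f x b =
  f↑ a b (subst₂ N._<_ (toℕ-inject₁ a) (toℕ-inject₁ b) i<j)
... | ‵inject₁ a | ‵fromℕ rewrite snoc-inject₁ f x a | snoc-fromℕ f x = f<x a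
... | ‵fromℕ | _ =
  ⊥-elim (<⇒≱ i<j (subst (toℕ j ≤_) (sym (toℕ-fromℕ k)) (toℕ≤pred[n] j)))

pair-increasing : ∀ {m} {i i' : Fin m} → i F.< i' → Increasing (i ∷ i' ∷ [])
pair-increasing i<i' F.zero (F.suc F.zero) _ = i<i'
pair-increasing i<i' (F.suc F.zero) (F.suc F.zero) (s≤s ())

<⇒<ᵇ≡true : ∀ {m n} → m N.< n → (m <ᵇ n) ≡ true
<⇒<ᵇ≡true m<n = Equivalence.to T-≡ (<⇒<ᵇ m<n)

<ᵇ-irrefl : ∀ n → (n <ᵇ n) ≡ false
<ᵇ-irrefl zero    = refl
<ᵇ-irrefl (suc n) = <ᵇ-irrefl n

contains-Q : ∀ {m n k} (A : Matrix m n) {i i' : Fin m} {c : Fin n} →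
  Picks k (λ j → A i j ≡ true × A i' j ≡ false × j F.< c) →
  i F.< i' → A i c ≡ false → A i' c ≡ false → Contains A (Q k)
contains-Q {k = k} A {i} {i'} {c} S i<i' Aic Ai'c =
  i ∷ i' ∷ [] , cols , pair-increasing i<i' ,
  snoc-increasing (index S) c (increasing S) (proj₂ ∘ proj₂ ∘ satisfies S) , entries
  where
  cols = snoc (index S) c
  entries : ∀ a b → A ((i ∷ i' ∷ []) a) (cols b) ≡ Q k a b
  entries F.zero b with view b
  ... | ‵inject₁ b′ rewrite snoc-inject₁ (index S) c b′ | toℕ-inject₁ b′ =
    trans (proj₁ (satisfies S b′)) (sym (<⇒<ᵇ≡true (toℕ<n b′)))
  ... | ‵fromℕ rewrite snoc-fromℕ (index S) c | toℕ-fromℕ k = trans Aic (sym (<ᵇ-irrefl k))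
  entries (F.suc F.zero) b with view b
  ... | ‵inject₁ b′ rewrite snoc-inject₁ (index S) c b′ = proj₁ (proj₂ (satisfies S b′))
  ... | ‵fromℕ rewrite snoc-fromℕ (index S) c = Ai'c

picks-∘ : ∀ {n l t} {P R : Fin n → Set} (S : Picks l P) → Picks t (R ∘ index S) →
  Picks t (λ j → R j × P j)
picks-∘ S T = record
  { index      = index S ∘ index T
  ; increasing = λ a b a<b → increasing S _ _ (increasing T a b a<b)
  ; satisfies  = λ a → satisfies T a , satisfies S (index T a)
  }

inject₁<fromℕ : ∀ {u} (a : Fin u) → inject₁ a F.< fromℕ u
inject₁<fromℕ {u} a = subst₂ N._<_ (sym (toℕ-inject₁ a)) (sym (toℕ-fromℕ u)) (toℕ<n a)

Q-free⇒few-ones : ∀ {m n k l} (A : Matrix m n) → Free A (Q (suc k)) →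
  {i i' : Fin m} {c : Fin n} → i F.< i' → A i c ≡ false → A i' c ≡ false →
  (S : Picks l (λ j → A i' j ≡ false × j F.< c)) → count (λ b → A i (index S b)) ≤ k
Q-free⇒few-ones {k = k} A free {i} i<i' Aic Ai'c S with count (λ b → A i (index S b)) ≤? k
... | yes few = few
... | no many = ⊥-elim (free (contains-Q A (picks-∘ S ones) i<i' Aic Ai'c))
  where ones = count⇒picks (λ b → A i (index S b)) (≰⇒> many)

module _ {n k u} (A : Matrix n n) (free : Free A (Q (suc k)))
         (many-zeros : n * (suc k * suc u) + n * u N.< zeros A) where

  private
    t m : ℕ
    t = suc u
    m = suc k * t

    -- late i j: the entry (i, j) is a zero preceded by at least m zeros in row i
    late : Fin n → Fin n → Bool
    late i = dropTrues m (not ∘ A i)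

    late-in-column : Fin n → ℕ
    late-in-column j = count (λ i → late i j)

    many-late : n * u N.< ∑[ j < n ] late-in-column j
    many-late = +-cancelˡ-≤ (n * m) _ _ (begin
      n * m + suc (n * u)                  ≡⟨ +-suc (n * m) (n * u) ⟩
      suc (n * m + n * u)                  ≤⟨ many-zeros ⟩
      zeros A                              ≡⟨ zeros≡sum-count A ⟩
      ∑[ i < n ] count (not ∘ A i)
        ≤⟨ sum-mono-≤ (λ i → count≤+count-dropTrues m (not ∘ A i)) ⟩
      ∑[ i < n ] (m + count (late i))       ≡⟨ ∑-distrib-+ (λ _ → m) (λ i → count (late i)) ⟩
      ∑[ _ < n ] m + ∑[ i < n ] count (late i)
        ≡⟨ cong₂ _+_ (sum-const n m) (∑-comm (λ i j → indicator (late i j))) ⟩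
      n * m + ∑[ j < n ] count (λ i → late i j) ∎)
      where open ≤-Reasoning

    c : Fin n
    c = proj₁ (sum-pigeonhole u late-in-column many-late)

    R : Picks t (λ i → late i c ≡ true)
    R = count⇒picks (λ i → late i c) (proj₂ (sum-pigeonhole u late-in-column many-late))

    r : Fin n
    r = index R (fromℕ u)

    S : Picks m (λ j → A r j ≡ false × j F.< c)
    S = picks-map (map₁ not-injective) (dropTrues⇒preceded m (not ∘ A r) c (satisfies R (fromℕ u)))

    zero-at-c : ∀ i → late i c ≡ true → A i c ≡ false
    zero-at-c i h = not-injective (dropTrues⇒true m (not ∘ A i) c h)

    ones-in-row : Fin t → ℕ
    ones-in-row a = count (λ b → A (index R a) (index S b))

    ones-in-column : Fin m → ℕ
    ones-in-column b = count (λ a → A (index R a) (index S b))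

    few-ones : ∀ a → ones-in-row a ≤ k
    few-ones a with view a
    ... | ‵inject₁ a′ = Q-free⇒few-ones A free (increasing R _ _ (inject₁<fromℕ a′))
      (zero-at-c _ (satisfies R (inject₁ a′))) (zero-at-c r (satisfies R (fromℕ u))) S
    ... | ‵fromℕ = ≤-trans (≤-reflexive (count-false _ (proj₁ ∘ satisfies S))) z≤n

    zero-column : Fin n → Bool
    zero-column j = count (λ a → A (index R a) j) ≡ᵇ 0

    many-zero-columns : t ≤ count (zero-column ∘ index S)
    many-zero-columns = +-cancelʳ-≤ (k * t) _ _ (begin
      t + k * t                                              ≤⟨ ≤-countZeros+sum ones-in-column ⟩
      count (zero-column ∘ index S) + ∑[ b < m ] ones-in-column b
        ≡⟨ cong (count (zero-column ∘ index S) +_)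
                (∑-comm (λ b a → indicator (A (index R a) (index S b)))) ⟩
      count (zero-column ∘ index S) + ∑[ a < t ] ones-in-row a
        ≤⟨ +-monoʳ-≤ (count (zero-column ∘ index S)) (sum-mono-≤ few-ones) ⟩
      count (zero-column ∘ index S) + ∑[ _ < t ] k
        ≡⟨ cong (count (zero-column ∘ index S) +_) (trans (sum-const t k) (*-comm t k)) ⟩
      count (zero-column ∘ index S) + k * t ∎)
      where open ≤-Reasoning

    C : Picks t (λ j → (zero-column j ≡ true) × (A r j ≡ false × j F.< c))
    C = picks-∘ S (count⇒picks (zero-column ∘ index S) many-zero-columns)

  Q-free⇒zero-submatrix : HasZeroSubmatrix A (suc u)
  Q-free⇒zero-submatrix = index R , index C , increasing R , increasing C ,
    λ a b → count≡ᵇ0⇒false (λ a → A (index R a) (index C b)) (proj₁ (satisfies C b)) a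

empty-submatrix : ∀ {n} (A : Matrix n n) → HasZeroSubmatrix A 0
empty-submatrix A = (λ ()) , (λ ()) , (λ ()) , (λ ()) , (λ ())

floor≡⇒≤ : ∀ q t → ℚ.floor q ≡ ℤ.+ t → mkℚᵘ (ℤ.+ t) 0 ℚᵘ.≤ ℚ.toℚᵘ q
floor≡⇒≤ (ℚ.mkℚ p d _) t floor≡t =
  ℚᵘ.*≤* (subst₂ ℤ._≤_ (cong (ℤ._* ℤ.+ suc d) floor≡t) (sym (ℤ.*-identityʳ p))
                       ([n/d]*d≤n p (ℤ.+ suc d)))

mkℚᵘ-pos-* : ∀ x y d e →
  mkℚᵘ (ℤ.+ x) d ℚᵘ.* mkℚᵘ (ℤ.+ y) e ≡ mkℚᵘ (ℤ.+ (x * y)) (pred (suc d * suc e))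
mkℚᵘ-pos-* x y d e = cong (λ z → mkℚᵘ z _) (sym (ℤ.pos-* x y))

mkℚᵘ-pos-≤ : ∀ {x y d e} → mkℚᵘ (ℤ.+ x) d ℚᵘ.≤ mkℚᵘ (ℤ.+ y) e → x * suc e ≤ y * suc d
mkℚᵘ-pos-≤ {x} {y} {d} {e} (ℚᵘ.*≤* x/d≤y/e) =
  ℤ.drop‿+≤+ (subst₂ ℤ._≤_ (sym (ℤ.pos-* x (suc e))) (sym (ℤ.pos-* y (suc d))) x/d≤y/e)

ℕ→ℚᵘ : ∀ n → ℚ.toℚᵘ (ℕ→ℚ n) ℚᵘ.≃ mkℚᵘ (ℤ.+ n) 0
ℕ→ℚᵘ n = ℚ.toℚᵘ-fromℚᵘ (mkℚᵘ (ℤ.+ n) 0)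

floor-εOver2k : ∀ a e .(c : Coprime a (suc e)) k n t →
  ℚ.floor (εOver2k (ℚ.mkℚ (ℤ.+ a) e c) (suc k) ℚ.* ℕ→ℚ n) ≡ ℤ.+ t →
  t * (suc e * (2 * suc k)) ≤ a * n
floor-εOver2k a e c k n t floor≡t =
  subst₂ _≤_ (cong (t *_) (*-identityʳ (suc e * (2 * suc k))))
             (trans (*-identityʳ (a * 1 * n)) (cong (_* n) (*-identityʳ a)))
    (mkℚᵘ-pos-≤ (ℚᵘ.≤-respʳ-≃ ε/2k*n≃ (floor≡⇒≤ _ t floor≡t)))
  where
  ε = ℚ.mkℚ (ℤ.+ a) e c
  1/2k = mkℚᵘ (ℤ.+ 1) (pred (2 * suc k))
  d = pred (suc e * (2 * suc k))
  ε/2k*n≃ : ℚ.toℚᵘ (εOver2k ε (suc k) ℚ.* ℕ→ℚ n) ℚᵘ.≃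
            mkℚᵘ (ℤ.+ (a * 1 * n)) (pred (suc d * 1))
  ε/2k*n≃ = begin-equality
    ℚ.toℚᵘ (εOver2k ε (suc k) ℚ.* ℕ→ℚ n)
      ≃⟨ ℚ.toℚᵘ-homo-* (εOver2k ε (suc k)) (ℕ→ℚ n) ⟩
    ℚ.toℚᵘ (εOver2k ε (suc k)) ℚᵘ.* ℚ.toℚᵘ (ℕ→ℚ n)
      ≃⟨ ℚᵘ.*-cong (ℚ.toℚᵘ-homo-* ε (ℤ.+ 1 ℚ./ (2 * suc k))) (ℕ→ℚᵘ n) ⟩
    (ℚ.toℚᵘ ε ℚᵘ.* ℚ.toℚᵘ (ℤ.+ 1 ℚ./ (2 * suc k))) ℚᵘ.* mkℚᵘ (ℤ.+ n) 0
      ≃⟨ ℚᵘ.*-congʳ (ℚᵘ.*-congˡ (ℚ.toℚᵘ-fromℚᵘ 1/2k)) ⟩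
    (ℚ.toℚᵘ ε ℚᵘ.* 1/2k) ℚᵘ.* mkℚᵘ (ℤ.+ n) 0
      ≡⟨ cong (ℚᵘ._* mkℚᵘ (ℤ.+ n) 0) (mkℚᵘ-pos-* a 1 e (pred (2 * suc k))) ⟩
    mkℚᵘ (ℤ.+ (a * 1)) d ℚᵘ.* mkℚᵘ (ℤ.+ n) 0
      ≡⟨ mkℚᵘ-pos-* (a * 1) n d 0 ⟩
    mkℚᵘ (ℤ.+ (a * 1 * n)) (pred (suc d * 1))
      ∎
    where open ℚᵘ.≤-Reasoning

ε*ℕ≤ℕ⇒≤ : ∀ a e .(c : Coprime a (suc e)) N Z →
  ℚ.mkℚ (ℤ.+ a) e c ℚ.* ℕ→ℚ N ℚ.≤ ℕ→ℚ Z → a * N ≤ Z * suc e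
ε*ℕ≤ℕ⇒≤ a e c N Z εN≤Z =
  subst₂ _≤_ (*-identityʳ (a * N)) (cong (Z *_) (*-identityʳ (suc e)))
    (mkℚᵘ-pos-≤ (ℚᵘ.≤-respˡ-≃ εN≃ (ℚᵘ.≤-respʳ-≃ (ℕ→ℚᵘ Z) (ℚ.toℚᵘ-mono-≤ εN≤Z))))
  where
  ε = ℚ.mkℚ (ℤ.+ a) e c
  εN≃ : ℚ.toℚᵘ (ε ℚ.* ℕ→ℚ N) ℚᵘ.≃ mkℚᵘ (ℤ.+ (a * N)) (pred (suc e * 1))
  εN≃ = begin-equality
    ℚ.toℚᵘ (ε ℚ.* ℕ→ℚ N)                   ≃⟨ ℚ.toℚᵘ-homo-* ε (ℕ→ℚ N) ⟩
    mkℚᵘ (ℤ.+ a) e ℚᵘ.* ℚ.toℚᵘ (ℕ→ℚ N)     ≃⟨ ℚᵘ.*-congˡ (ℕ→ℚᵘ N) ⟩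
    mkℚᵘ (ℤ.+ a) e ℚᵘ.* mkℚᵘ (ℤ.+ N) 0     ≡⟨ mkℚᵘ-pos-* a N e 0 ⟩
    mkℚᵘ (ℤ.+ (a * N)) (pred (suc e * 1))  ∎
    where open ℚᵘ.≤-Reasoning

enough-zeros : ∀ k e a n u Z →
  suc u * (suc e * (2 * suc k)) ≤ a * n → a * (n * n) ≤ Z * suc e →
  n * (suc k * suc u) + n * u N.< Z
enough-zeros k e a zero u Z t≤εn _ =
  ⊥-elim (<⇒≱ N.z<s (≤-trans t≤εn (≤-reflexive (*-zeroʳ a))))
enough-zeros k e a n@(suc _) u Z t≤εn εn²≤Z = begin-strict
  n * (K * t) + n * u
    <⟨ +-monoʳ-< (n * (K * t)) (≤-trans n*u<n*t (*-monoʳ-≤ n (m≤n*m t K))) ⟩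
  n * (K * t) + n * (K * t) ≡⟨ twice-comm n K t ⟩
  2 * K * t * n             ≤⟨ *-cancelˡ-≤ D (begin
    D * (2 * K * t * n)       ≡⟨ rearrange D K t n ⟩
    t * (D * (2 * K)) * n     ≤⟨ *-monoˡ-≤ n t≤εn ⟩
    a * n * n                 ≡⟨ *-assoc a n n ⟩
    a * (n * n)               ≤⟨ εn²≤Z ⟩
    Z * D                     ≡⟨ *-comm Z D ⟩
    D * Z                     ∎) ⟩
  Z                         ∎
  where
  open ≤-Reasoning
  K = suc k
  t = suc u
  D = suc e
  n*u<n*t : n * u N.< n * t
  n*u<n*t = *-monoʳ-< n (n<1+n u)
  twice-comm : ∀ x y z → x * (y * z) + x * (y * z) ≡ 2 * y * z * x
  twice-comm = solve-∀
  rearrange : ∀ w x y z → w * (2 * x * y * z) ≡ y * (w * (2 * x)) * z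
  rearrange = solve-∀

lemma5p1 : (k : ℕ) .{{_ : NonZero k}} (ε : ℚ) → 0ℚ < ε → Good ε (εOver2k ε k) (Q k)
lemma5p1 (suc k) (ℚ.mkℚ -[1+ _ ] _ _) (ℚ.*<* ())
lemma5p1 (suc k) ε@(ℚ.mkℚ (ℤ.+ a) e c) _ n A free εn²≤zeros
  with ℚ.floor (εOver2k ε (suc k) ℚ.* ℕ→ℚ n) in floor≡t
... | -[1+ _ ]    = 0 , ℤ.-≤+ , empty-submatrix A
... | ℤ.+ zero    = 0 , ℤ.≤-refl , empty-submatrix A
... | ℤ.+ suc u   = suc u , ℤ.≤-refl , Q-free⇒zero-submatrix A free
  (enough-zeros k e a n u (zeros A) (floor-εOver2k a e c k n (suc u) floor≡t)
                                    (ε*ℕ≤ℕ⇒≤ a e c (n * n) (zeros A) εn²≤zeros))
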